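{- Let $\Gamma=(V,E)$ be a finite, simple, connected graph of valency $2r$ for some prime $r$, and let $G\le\mathrm{Aut}\,\Gamma$ be transitive on $V$ and $E$ but not transitive on the set of $2$-arcs of $\Gamma$. Suppose $G$ is intransitive on the arc set of $\Gamma$, and let $N$ be a normal subgroup of $G$ that is transitive on $V$; let $\alpha\in V$. Then either $N$ is regular on $V$, or $r=\max\pi(N_\alpha)$ and $N$ is transitive on both $V$ and $E$.
   Context: A $2$-arc is a triple $(\alpha,\beta,\gamma)$ of vertices with $\alpha\ne\gamma$ and $\{\alpha,\beta\},\{\beta,\gamma\}\in E$; arcs are ordered pairs $(\alpha,\beta)$ with $\{\alpha,\beta\}\in E$. $N_\alpha$ is the stabilizer of $\alpha$ in $N$, and $\pi(Y)$ is the set of prime divisors of $|Y|$. -}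

module Defs where

open import Data.Nat using (ℕ; _*_; _≤_)
open import Data.Nat.Divisibility using (_∣_)
open import Data.Nat.Primality using (Prime)
open import Data.Fin using (Fin; _≟_)
open import Data.Fin.Permutation using (Permutation′; _⟨$⟩ʳ_; _⟨$⟩ˡ_)
open import Data.Bool using (Bool; true; false)
open import Data.List using (List; length; filterᵇ; allFin)
open import Data.List.Relation.Unary.Any using (Any)
open import Data.List.Relation.Unary.AllPairs using (AllPairs)
open import Data.Product using (Σ; _×_; ∃)
open import Data.Sum using (_⊎_)
open import Relation.Nullary using (¬_; does)
open import Relation.Binary.PropositionalEquality using (_≡_)

record Graph (n : ℕ) : Set where
  field
    adj   : Fin n → Fin n → Bool
    sym   : ∀ x y → adj x y ≡ adj y x
    irrefl : ∀ x → adj x x ≡ false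
open Graph public

Adj : ∀ {n} → Graph n → Fin n → Fin n → Set
Adj Γ x y = adj Γ x y ≡ true

data Reach {n} (Γ : Graph n) : Fin n → Fin n → Set where
  here : ∀ {x} → Reach Γ x x
  step : ∀ {x y z} → Adj Γ x y → Reach Γ y z → Reach Γ x z

Connected : ∀ {n} → Graph n → Set
Connected Γ = ∀ x y → Reach Γ x y

degree : ∀ {n} → Graph n → Fin n → ℕ
degree {n} Γ v = length (filterᵇ (adj Γ v) (allFin n))

Regular : ∀ {n} → Graph n → ℕ → Set
Regular Γ k = ∀ v → degree Γ v ≡ k

_≗ₚ_ : ∀ {n} → Permutation′ n → Permutation′ n → Set
g ≗ₚ h = ∀ i → g ⟨$⟩ʳ i ≡ h ⟨$⟩ʳ i

record PermGroup (n : ℕ) : Set where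
  field
    elems    : List (Permutation′ n)
    distinct : AllPairs (λ g h → ¬ (g ≗ₚ h)) elems
    has-id   : Any (λ h → ∀ i → h ⟨$⟩ʳ i ≡ i) elems
    has-comp : ∀ g h → Any (g ≗ₚ_) elems → Any (h ≗ₚ_) elems →
               Any (λ k → ∀ i → k ⟨$⟩ʳ i ≡ h ⟨$⟩ʳ (g ⟨$⟩ʳ i)) elems
    has-inv  : ∀ g → Any (g ≗ₚ_) elems →
               Any (λ k → ∀ i → k ⟨$⟩ʳ i ≡ g ⟨$⟩ˡ i) elems
open PermGroup public

_∈G_ : ∀ {n} → Permutation′ n → PermGroup n → Set
g ∈G G = Any (g ≗ₚ_) (elems G)

order : ∀ {n} → PermGroup n → ℕ
order G = length (elems G)

stabOrder : ∀ {n} → PermGroup n → Fin n → ℕ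
stabOrder G α = length (filterᵇ (λ g → does (g ⟨$⟩ʳ α ≟ α)) (elems G))

IsAutGroup : ∀ {n} → Graph n → PermGroup n → Set
IsAutGroup Γ G = ∀ g → g ∈G G → ∀ x y → adj Γ (g ⟨$⟩ʳ x) (g ⟨$⟩ʳ y) ≡ adj Γ x y

IsNormalSubgroup : ∀ {n} → PermGroup n → PermGroup n → Set
IsNormalSubgroup N G =
  (∀ h → h ∈G N → h ∈G G) ×
  (∀ g h → g ∈G G → h ∈G N →
     Any (λ k → ∀ i → k ⟨$⟩ʳ i ≡ g ⟨$⟩ʳ (h ⟨$⟩ʳ (g ⟨$⟩ˡ i))) (elems N))

VertexTransitive : ∀ {n} → PermGroup n → Set
VertexTransitive G = ∀ x y → Σ _ λ g → g ∈G G × g ⟨$⟩ʳ x ≡ y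

-- edges are unordered pairs {x,y}
EdgeTransitive : ∀ {n} → Graph n → PermGroup n → Set
EdgeTransitive Γ G = ∀ x y u v → Adj Γ x y → Adj Γ u v →
  Σ _ λ g → g ∈G G ×
    ((g ⟨$⟩ʳ x ≡ u × g ⟨$⟩ʳ y ≡ v) ⊎ (g ⟨$⟩ʳ x ≡ v × g ⟨$⟩ʳ y ≡ u))

ArcTransitive : ∀ {n} → Graph n → PermGroup n → Set
ArcTransitive Γ G = ∀ x y u v → Adj Γ x y → Adj Γ u v →
  Σ _ λ g → g ∈G G × g ⟨$⟩ʳ x ≡ u × g ⟨$⟩ʳ y ≡ v

TwoArc : ∀ {n} → Graph n → Fin n → Fin n → Fin n → Set
TwoArc Γ a b c = ¬ (a ≡ c) × Adj Γ a b × Adj Γ b c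

TwoArcTransitive : ∀ {n} → Graph n → PermGroup n → Set
TwoArcTransitive Γ G = ∀ a b c a′ b′ c′ → TwoArc Γ a b c → TwoArc Γ a′ b′ c′ →
  Σ _ λ g → g ∈G G × g ⟨$⟩ʳ a ≡ a′ × g ⟨$⟩ʳ b ≡ b′ × g ⟨$⟩ʳ c ≡ c′

RegularOn : ∀ {n} → PermGroup n → Set
RegularOn G = VertexTransitive G ×
  (∀ g x → g ∈G G → g ⟨$⟩ʳ x ≡ x → ∀ i → g ⟨$⟩ʳ i ≡ i)

IsMaxPrimeDivisor : ℕ → ℕ → Set
IsMaxPrimeDivisor r m = Prime r × r ∣ m × (∀ p → Prime p → p ∣ m → p ≤ r)

module Submission where

-- Edge- but not arc-transitivity of G orients Γ: each edge has exactly one orientation x ⇀ y in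
-- the G-orbit of a fixed arc (a, b).  Orbit–stabiliser gives |G_a| = out(a)·|G_ab| = |G_b| =
-- in(b)·|G_ab|, so every vertex has r out- and r in-neighbours.  For N ⊴ G, G_x permutes the
-- N_x-orbits on the out-neighbours of x transitively; they have a common size dividing the
-- prime r, so N_x either fixes all out-neighbours or is transitive on them.  If N_x is
-- "locally trivial" at one vertex it is so at all, N_x then also fixes in-neighbours (equal
-- stabiliser orders), and by connectivity N is semiregular.  Hence either N is regular, or N is
-- "locally transitive" everywhere: then N is transitive on oriented arcs, hence on edges, and
-- r ∣ |N_α|; finally extending S ∋ α along edges, |N_S| = |orbit|·|N_{z∷S}| with orbits of size
-- ≤ r bounds every prime divisor of |N_α| by r.

open import Defs
open import Data.Nat.Primality using (Prime; euclidsLemma; prime⇒irreducible; prime⇒nonTrivial; ¬prime[1])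
open import Data.Bool using (T; T?)
open import Data.Bool.Properties using (T-≡)
open import Data.Unit using (tt)
open import Data.Fin using (Fin; _≟_)
open import Data.Fin.Properties using (any?; all?)
open import Data.Fin.Permutation using (Permutation′; _⟨$⟩ʳ_; _⟨$⟩ˡ_; inverseˡ; inverseʳ; flip)
open import Data.List using (List; []; _∷_; length; filter; allFin)
open import Data.List.Properties using (length-tabulate; length-filter; filter-≐)
open import Data.List.Relation.Unary.Any as Any using (Any; here; there)
open import Data.List.Relation.Unary.All as All using (All; []; _∷_)
open import Data.List.Relation.Unary.AllPairs using (AllPairs; []; _∷_)
import Data.List.Relation.Unary.AllPairs.Properties as AllPairs
open import Data.List.Relation.Unary.Unique.Propositional.Properties using (allFin⁺)
open import Data.List.Membership.Propositional using (_∈_)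
open import Data.List.Membership.Propositional.Properties using (∈-allFin; ∈-filter⁺; ∈-filter⁻)
import Data.List.Membership.Setoid.Properties as SetoidMembership
open import Data.Product using (Σ; _×_; _,_; proj₁; proj₂)
open import Data.Sum using (_⊎_; inj₁; inj₂; [_,_]′)
open import Data.Empty using (⊥-elim)
open import Data.Nat using (ℕ; zero; suc; _+_; _*_; _≤_; _<_; z≤n; s≤s; NonZero; >-nonZero; nonTrivial⇒n>1)
open import Data.Nat.Properties hiding (_≟_)
open import Data.Nat.Divisibility using (_∣_; _∣0; ∣⇒≤; ∣1⇒≡1; m∣m*n; ∣m∣n⇒∣m+n; ∣-refl)
open import Function.Bundles using (Equivalence)
open import Level using (0ℓ)
open import Relation.Binary.Bundles using (Setoid)
open import Relation.Binary.PropositionalEquality as ≡ using (_≡_; refl; trans; cong; cong₂; subst; subst₂)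
open import Relation.Nullary using (¬_; Dec; yes; no; ¬?; does)
open import Relation.Nullary.Decidable using (_×-dec_)
open import Relation.Unary using (Decidable)

module Counting {A : Set} where

  count : {P : A → Set} → Decidable P → List A → ℕ
  count P? xs = length (filter P? xs)

  count-split : {P : A → Set} (P? : Decidable P) (xs : List A) →
    length xs ≡ count P? xs + count (λ x → ¬? (P? x)) xs
  count-split P? [] = refl
  count-split P? (x ∷ xs) with P? x
  ... | yes _ = cong suc (count-split P? xs)
  ... | no _ = trans (cong suc (count-split P? xs)) (≡.sym (+-suc _ _))

  count-cong : {P Q : A → Set} (P? : Decidable P) (Q? : Decidable Q) (xs : List A) →
    (∀ x → P x → Q x) → (∀ x → Q x → P x) → count P? xs ≡ count Q? xs
  count-cong P? Q? xs P⇒Q Q⇒P = cong length (filter-≐ P? Q? ((λ {x} → P⇒Q x) , (λ {x} → Q⇒P x)) xs)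

  count-filter-weaker : {P Q : A → Set} (P? : Decidable P) (Q? : Decidable Q) (xs : List A) →
    (∀ x → Q x → P x) → count Q? (filter P? xs) ≡ count Q? xs
  count-filter-weaker P? Q? [] Q⇒P = refl
  count-filter-weaker P? Q? (x ∷ xs) Q⇒P with P? x
  ... | yes _ with Q? x
  ...   | yes _ = cong suc (count-filter-weaker P? Q? xs Q⇒P)
  ...   | no _ = count-filter-weaker P? Q? xs Q⇒P
  count-filter-weaker P? Q? (x ∷ xs) Q⇒P | no ¬p with Q? x
  ...   | yes q = ⊥-elim (¬p (Q⇒P x q))
  ...   | no _ = count-filter-weaker P? Q? xs Q⇒P

  count-filter-∧ : {P Q : A → Set} (P? : Decidable P) (Q? : Decidable Q) (xs : List A) →
    count Q? (filter P? xs) ≡ count (λ x → P? x ×-dec Q? x) xs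
  count-filter-∧ P? Q? [] = refl
  count-filter-∧ P? Q? (x ∷ xs) with P? x
  ... | no _ = count-filter-∧ P? Q? xs
  ... | yes _ with Q? x
  ...   | yes _ = cong suc (count-filter-∧ P? Q? xs)
  ...   | no _ = count-filter-∧ P? Q? xs

  count-pos : {P : A → Set} (P? : Decidable P) (xs : List A) → Any P xs → 1 ≤ count P? xs
  count-pos P? (x ∷ xs) p with P? x
  ... | yes _ = s≤s z≤n
  count-pos P? (x ∷ xs) (here px) | no ¬px = ⊥-elim (¬px px)
  count-pos P? (x ∷ xs) (there p) | no _ = count-pos P? xs p

  count-witness : {P : A → Set} (P? : Decidable P) (xs : List A) → 1 ≤ count P? xs → Σ A P
  count-witness P? (x ∷ xs) pos with P? x
  ... | yes px = x , px
  ... | no _ = count-witness P? xs pos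

  count-mono-≤ : {P Q : A → Set} (P? : Decidable P) (Q? : Decidable Q) (xs : List A) →
    All (λ x → P x → Q x) xs → count P? xs ≤ count Q? xs
  count-mono-≤ P? Q? [] [] = z≤n
  count-mono-≤ P? Q? (x ∷ xs) (P⇒Q ∷ P⇒Qs) with P? x | Q? x
  ... | yes _ | yes _ = s≤s (count-mono-≤ P? Q? xs P⇒Qs)
  ... | yes p | no ¬q = ⊥-elim (¬q (P⇒Q p))
  ... | no _ | yes _ = m≤n⇒m≤1+n (count-mono-≤ P? Q? xs P⇒Qs)
  ... | no _ | no _ = count-mono-≤ P? Q? xs P⇒Qs

  count-mono-< : {P Q : A → Set} (P? : Decidable P) (Q? : Decidable Q) (xs : List A) →
    All (λ x → P x → Q x) xs → Any (λ x → Q x × ¬ P x) xs → count P? xs < count Q? xs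
  count-mono-< P? Q? (x ∷ xs) (P⇒Q ∷ P⇒Qs) w with P? x | Q? x
  count-mono-< P? Q? (x ∷ xs) _ (here (_ , ¬p)) | yes p | _ = ⊥-elim (¬p p)
  count-mono-< P? Q? (x ∷ xs) (_ ∷ P⇒Qs) (there w) | yes p | yes _ = s≤s (count-mono-< P? Q? xs P⇒Qs w)
  ... | yes p | no ¬q = ⊥-elim (¬q (P⇒Q p))
  count-mono-< P? Q? (x ∷ xs) _ (here (q , _)) | no _ | no ¬q = ⊥-elim (¬q q)
  count-mono-< P? Q? (x ∷ xs) (_ ∷ P⇒Qs) (there w) | no _ | no _ = count-mono-< P? Q? xs P⇒Qs w
  count-mono-< P? Q? (x ∷ xs) (_ ∷ P⇒Qs) _ | no _ | yes _ = s≤s (count-mono-≤ P? Q? xs P⇒Qs)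

  All-filter : {P Q : A → Set} (Q? : Decidable Q) (xs : List A) →
    All (λ x → Q x → P x) xs → All P (filter Q? xs)
  All-filter Q? [] [] = []
  All-filter Q? (x ∷ xs) (f ∷ fs) with Q? x
  ... | yes q = f q ∷ All-filter Q? xs fs
  ... | no _ = All-filter Q? xs fs

open Counting

module Injection {A : Set} (_~_ : A → A → Set) (S : Setoid 0ℓ 0ℓ)
  (_≈?_ : ∀ x y → Dec (Setoid._≈_ S x y)) where
  open Setoid S using (_≈_) renaming (Carrier to B; sym to ≈-sym; trans to ≈-trans)
  open import Data.List.Membership.Setoid S using () renaming (_∈_ to _∈ₛ_)

  without : B → List B → List B
  without y ys = filter (λ y′ → ¬? (y ≈? y′)) ys

  length-without : ∀ y ys → y ∈ₛ ys → length (without y ys) < length ys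
  length-without y (y′ ∷ ys) y∈ with y ≈? y′
  ... | yes _ = s≤s (length-filter (λ y″ → ¬? (y ≈? y″)) ys)
  length-without y (y′ ∷ ys) (here y≈y′) | no y≉y′ = ⊥-elim (y≉y′ y≈y′)
  length-without y (y′ ∷ ys) (there y∈) | no _ = s≤s (length-without y ys y∈)

  ∈-without : ∀ {y y′ ys} → y′ ∈ₛ ys → ¬ y ≈ y′ → y′ ∈ₛ without y ys
  ∈-without {y} y′∈ y≉y′ = SetoidMembership.∈-filter⁺ S (λ y″ → ¬? (y ≈? y″))
    (λ e y≉ y≈ → y≉ (≈-trans y≈ (≈-sym e))) y′∈ y≉y′

  injection-length-≤ : (R : A → B → Set) (xs : List A) (ys : List B) →
    AllPairs (λ x x′ → ¬ x ~ x′) xs →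
    All (λ x → Σ B λ y → y ∈ₛ ys × R x y) xs →
    (∀ {x x′ y y′} → R x y → R x′ y′ → y ≈ y′ → x ~ x′) →
    length xs ≤ length ys
  injection-length-≤ R [] ys _ _ _ = z≤n
  injection-length-≤ R (x ∷ xs) ys (x≁ ∷ distinct) ((y , y∈ , Rxy) ∷ images) inj =
    ≤-trans (s≤s (injection-length-≤ R xs (without y ys) distinct (images′ xs x≁ images) inj))
            (length-without y ys y∈)
    where
    images′ : ∀ xs → All (λ x′ → ¬ x ~ x′) xs → All (λ x′ → Σ B λ y′ → y′ ∈ₛ ys × R x′ y′) xs →
      All (λ x′ → Σ B λ y′ → y′ ∈ₛ without y ys × R x′ y′) xs
    images′ [] [] [] = []
    images′ (x′ ∷ xs) (x≁x′ ∷ x≁s) ((y′ , y′∈ , Rx′y′) ∷ rest) =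
      (y′ , ∈-without y′∈ (λ y≈y′ → x≁x′ (inj Rxy Rx′y′ y≈y′)) , Rx′y′) ∷ images′ xs x≁s rest

length-by-fibres : {A B : Set} (_≟B_ : (y y′ : B) → Dec (y ≡ y′)) (f : A → B)
  (xs : List A) (ys : List B) → AllPairs (λ y y′ → ¬ y ≡ y′) ys →
  All (λ x → f x ∈ ys) xs → (c : ℕ) →
  All (λ y → count (λ x → f x ≟B y) xs ≡ c) ys → length xs ≡ length ys * c
length-by-fibres _≟B_ f [] [] _ _ c _ = refl
length-by-fibres _≟B_ f (x ∷ xs) [] _ (() ∷ _) c _
length-by-fibres {A} _≟B_ f xs (y ∷ ys) (y∉ ∷ distinct) into c (fy ∷ fibres) =
  trans (count-split (λ x → f x ≟B y) xs)
        (cong₂ _+_ fy (length-by-fibres _≟B_ f rest ys distinct into′ c fibres′))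
  where
  rest : List A
  rest = filter (λ x → ¬? (f x ≟B y)) xs
  into′ : All (λ x → f x ∈ ys) rest
  into′ = All-filter (λ x → ¬? (f x ≟B y)) xs (All.map drop-y into)
    where
    drop-y : ∀ {x} → f x ∈ (y ∷ ys) → ¬ f x ≡ y → f x ∈ ys
    drop-y (here e) ne = ⊥-elim (ne e)
    drop-y (there m) _ = m
  fibres′ : All (λ y′ → count (λ x → f x ≟B y′) rest ≡ c) ys
  fibres′ = All.zipWith (λ (y≢y′ , e) → trans (count-filter-weaker (λ x → ¬? (f x ≟B y)) (λ x → f x ≟B _) xs
              (λ x fx≡y′ fx≡y → y≢y′ (trans (≡.sym fx≡y) fx≡y′))) e) (y∉ , fibres)

-- If an equivalence relation R on a duplicate-free list xs has all its classes of size s,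
-- then s divides |xs|.  (Induction on a bound for |xs|: remove the class of the head.)
equal-classes-divide : {B : Set} (R : B → B → Set) (R? : ∀ x y → Dec (R x y))
  (R-refl : ∀ {x} → R x x) (R-sym : ∀ {x y} → R x y → R y x)
  (R-trans : ∀ {x y z} → R x y → R y z → R x z)
  (bound : ℕ) (xs : List B) → length xs ≤ bound → AllPairs (λ x y → ¬ x ≡ y) xs →
  (s : ℕ) → All (λ x → count (R? x) xs ≡ s) xs → s ∣ length xs
equal-classes-divide R R? R-refl R-sym R-trans bound [] _ _ s _ = s ∣0
equal-classes-divide R R? R-refl R-sym R-trans zero (x ∷ xs) () _ _ _
equal-classes-divide {B} R R? R-refl R-sym R-trans (suc bound) (x ∷ xs) len distinct s (class-x ∷ classes) =
  subst (s ∣_) (≡.sym split) (∣m∣n⇒∣m+n ∣-refl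
    (equal-classes-divide R R? R-refl R-sym R-trans bound others len′
      (AllPairs.filter⁺ (λ y → ¬? (R? x y)) distinct) s classes′))
  where
  others : List B
  others = filter (λ y → ¬? (R? x y)) (x ∷ xs)
  split : length (x ∷ xs) ≡ s + length others
  split = trans (count-split (R? x) (x ∷ xs)) (cong (_+ length others) class-x)
  s≥1 : 1 ≤ s
  s≥1 = subst (1 ≤_) class-x (count-pos (R? x) (x ∷ xs) (here R-refl))
  len′ : length others ≤ bound
  len′ = ≤-pred (≤-trans (+-monoˡ-≤ (length others) s≥1) (subst (_≤ suc bound) split len))
  -- classes of elements outside the class of x are untouched by removing that class
  classes′ : All (λ y → count (R? y) others ≡ s) others
  classes′ = All-filter (λ y → ¬? (R? x y)) (x ∷ xs) (All.map (λ {y} e ¬xy →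
    trans (count-filter-weaker (λ w → ¬? (R? x w)) (R? y) (x ∷ xs)
             (λ w yw xw → ¬xy (R-trans xw (R-sym yw)))) e) (class-x ∷ classes))

module Permutations {n : ℕ} where

  Perm : Set
  Perm = Permutation′ n

  perm-setoid : Setoid 0ℓ 0ℓ
  perm-setoid = record
    { Carrier = Perm ; _≈_ = _≗ₚ_
    ; isEquivalence = record { refl = λ _ → refl ; sym = λ e i → ≡.sym (e i) ; trans = λ e f i → trans (e i) (f i) } }

  _≗?_ : (g h : Perm) → Dec (g ≗ₚ h)
  g ≗? h = all? (λ i → g ⟨$⟩ʳ i ≟ h ⟨$⟩ʳ i)

  ⟨$⟩ʳ-injective : (g : Perm) {x y : Fin n} → g ⟨$⟩ʳ x ≡ g ⟨$⟩ʳ y → x ≡ y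
  ⟨$⟩ʳ-injective g e = trans (≡.sym (inverseˡ g)) (trans (cong (g ⟨$⟩ˡ_) e) (inverseˡ g))

  ⟨$⟩ˡ-injective : (g : Perm) {x y : Fin n} → g ⟨$⟩ˡ x ≡ g ⟨$⟩ˡ y → x ≡ y
  ⟨$⟩ˡ-injective g e = trans (≡.sym (inverseʳ g)) (trans (cong (g ⟨$⟩ʳ_) e) (inverseʳ g))

  fixed-by-inverse : (g : Perm) {v : Fin n} → g ⟨$⟩ʳ v ≡ v → g ⟨$⟩ˡ v ≡ v
  fixed-by-inverse g e = trans (cong (g ⟨$⟩ˡ_) (≡.sym e)) (inverseˡ g)

  Fixes : List (Fin n) → Perm → Set
  Fixes S g = All (λ v → g ⟨$⟩ʳ v ≡ v) S

  fixes? : (S : List (Fin n)) (g : Perm) → Dec (Fixes S g)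
  fixes? S g = All.all? (λ v → g ⟨$⟩ʳ v ≟ v) S

  fixes-resp : ∀ {S g h} → g ≗ₚ h → Fixes S g → Fixes S h
  fixes-resp g≗h = All.map (λ {v} gv → trans (≡.sym (g≗h v)) gv)

  member-witness : {P : Perm → Set} {gs : List Perm} → Any P gs → Σ Perm λ g → Any (g ≗ₚ_) gs × P g
  member-witness (here {g} p) = g , here (λ _ → refl) , p
  member-witness (there w) with member-witness w
  ... | g , g∈ , p = g , there g∈ , p

  ∈⇒∈ₚ : {g : Perm} {gs : List Perm} → g ∈ gs → Any (g ≗ₚ_) gs
  ∈⇒∈ₚ = Any.map (λ { refl _ → refl })

open Permutations

module FinCounting (n : ℕ) where

  points : List (Fin n)
  points = allFin n

  ∈-points-filter : {P : Fin n → Set} (P? : Decidable P) {w : Fin n} → P w → w ∈ filter P? points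
  ∈-points-filter P? p = ∈-filter⁺ P? (∈-allFin _) p

  points-filter-distinct : {P : Fin n → Set} (P? : Decidable P) → AllPairs (λ x y → ¬ x ≡ y) (filter P? points)
  points-filter-distinct P? = AllPairs.filter⁺ P? (allFin⁺ n)

  open Injection {Fin n} _≡_ (≡.setoid (Fin n)) _≟_ using (injection-length-≤)

  distinct-≤-count : (xs : List (Fin n)) {Q : Fin n → Set} (Q? : Decidable Q) →
    AllPairs (λ x y → ¬ x ≡ y) xs → All Q xs → length xs ≤ count Q? points
  distinct-≤-count xs Q? distinct all-Q = injection-length-≤ _≡_ xs (filter Q? points) distinct
    (All.map (λ q → _ , ∈-points-filter Q? q , refl) all-Q)
    (λ e e′ e″ → trans e (trans e″ (≡.sym e′)))

  count-≤-image : (g : Permutation′ n) {P Q : Fin n → Set} (P? : Decidable P) (Q? : Decidable Q) →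
    (∀ w → P w → Q (g ⟨$⟩ʳ w)) → count P? points ≤ count Q? points
  count-≤-image g P? Q? into = injection-length-≤ (λ w w′ → g ⟨$⟩ʳ w ≡ w′) (filter P? points) (filter Q? points)
    (points-filter-distinct P?)
    (All.tabulate (λ m → _ , ∈-points-filter Q? (into _ (proj₂ (∈-filter⁻ P? {xs = points} m))) , refl))
    (λ e e′ e″ → ⟨$⟩ʳ-injective g (trans e (trans e″ (≡.sym e′))))

  count-transport : (g : Permutation′ n) {P Q : Fin n → Set} (P? : Decidable P) (Q? : Decidable Q) →
    (∀ w → P w → Q (g ⟨$⟩ʳ w)) → (∀ w → Q w → P (g ⟨$⟩ˡ w)) → count P? points ≡ count Q? points
  count-transport g P? Q? forward backward =
    ≤-antisym (count-≤-image g P? Q? forward) (count-≤-image (flip g) Q? P? backward)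

  outside? : (S : List (Fin n)) → Decidable (λ v → ¬ v ∈ S)
  outside? S v = ¬? (Any.any? (v ≟_) S)

  missing : List (Fin n) → ℕ
  missing S = count (outside? S) points

  missing-decreases : ∀ {S z} → ¬ z ∈ S → missing (z ∷ S) < missing S
  missing-decreases {S} {z} z∉ = count-mono-< (outside? (z ∷ S)) (outside? S) points
    (All.tabulate (λ _ v∉ v∈ → v∉ (there v∈))) (Any.map (λ { refl → z∉ , (λ z∉′ → z∉′ (here refl)) }) (∈-allFin z))

  count-everything : {P : Fin n → Set} (P? : Decidable P) → (∀ w → P w) → count P? points ≡ n
  count-everything P? all-P = trans (cong length (filter-≐ P? (λ _ → yes tt) ((λ _ → tt) , λ {w} _ → all-P w) points))
    (trans (filter-all points) (length-tabulate (λ x → x)))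
    where
    filter-all : (xs : List (Fin n)) → length (filter (λ (_ : Fin n) → yes tt) xs) ≡ length xs
    filter-all [] = refl
    filter-all (x ∷ xs) = cong suc (filter-all xs)

does-sound : {P : Set} (P? : Dec P) → T (does P?) → P
does-sound (yes p) _ = p

does-complete : {P : Set} (P? : Dec P) → P → T (does P?)
does-complete (yes _) _ = tt
does-complete (no ¬p) p = ⊥-elim (¬p p)

nonZero-of-Fin : ∀ {n} → Fin n → NonZero n
nonZero-of-Fin {suc _} _ = _

module GroupTheory {n : ℕ} (X : PermGroup n) where
  open FinCounting n
  open Injection {Permutation′ n} _≗ₚ_ (perm-setoid {n}) _≗?_ using (injection-length-≤)

  identity : Σ Perm λ e → e ∈G X × (∀ i → e ⟨$⟩ʳ i ≡ i)
  identity = member-witness (has-id X)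

  compose : ∀ g h → g ∈G X → h ∈G X → Σ Perm λ k → k ∈G X × (∀ i → k ⟨$⟩ʳ i ≡ h ⟨$⟩ʳ (g ⟨$⟩ʳ i))
  compose g h g∈ h∈ = member-witness (has-comp X g h g∈ h∈)

  inverse : ∀ g → g ∈G X → Σ Perm λ k → k ∈G X × (∀ i → k ⟨$⟩ʳ i ≡ g ⟨$⟩ˡ i)
  inverse g g∈ = member-witness (has-inv X g g∈)

  Stab : List (Fin n) → List Perm
  Stab S = filter (fixes? S) (elems X)

  stab-distinct : ∀ S → AllPairs (λ g h → ¬ g ≗ₚ h) (Stab S)
  stab-distinct S = AllPairs.filter⁺ (fixes? S) (distinct X)

  stab⁻ : ∀ S k → Any (k ≗ₚ_) (Stab S) → k ∈G X × Fixes S k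
  stab⁻ S k = SetoidMembership.∈-filter⁻ (perm-setoid {n}) (fixes? S) (λ {g} {h} → fixes-resp {S = S} {g = g} {h = h}) {v = k}

  stab⁺ : ∀ S k → k ∈G X → Fixes S k → Any (k ≗ₚ_) (Stab S)
  stab⁺ S k = SetoidMembership.∈-filter⁺ (perm-setoid {n}) (fixes? S) (λ {g} {h} → fixes-resp {S = S} {g = g} {h = h}) {v = k}

  stab-nonempty : ∀ S → 1 ≤ length (Stab S)
  stab-nonempty S with identity
  ... | e , e∈ , e-id = count-pos (fixes? S) (elems X)
    (Any.map (λ {g} e≗g → fixes-resp {S = S} {g = e} {h = g} e≗g (All.tabulate (λ _ → e-id _))) e∈)

  stab-swap : ∀ x y S → length (Stab (x ∷ y ∷ S)) ≡ length (Stab (y ∷ x ∷ S))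
  stab-swap x y S = count-cong (fixes? (x ∷ y ∷ S)) (fixes? (y ∷ x ∷ S)) (elems X)
    (λ { g (p ∷ q ∷ f) → q ∷ p ∷ f }) (λ { g (p ∷ q ∷ f) → q ∷ p ∷ f })

  Orbit : List (Fin n) → Fin n → Fin n → Set
  Orbit S z y = Any (λ k → k ⟨$⟩ʳ z ≡ y) (Stab S)

  orbit? : ∀ S z y → Dec (Orbit S z y)
  orbit? S z y = Any.any? (λ k → k ⟨$⟩ʳ z ≟ y) (Stab S)

  orbit⁻ : ∀ S {z y} → Orbit S z y → Σ Perm λ k → k ∈G X × Fixes S k × k ⟨$⟩ʳ z ≡ y
  orbit⁻ S o with member-witness o
  ... | k , k∈S , kz with stab⁻ S k k∈S
  ... | k∈ , k-fixes = k , k∈ , k-fixes , kz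

  orbit⁺ : ∀ S k {z y} → k ∈G X → Fixes S k → k ⟨$⟩ʳ z ≡ y → Orbit S z y
  orbit⁺ S k {z} k∈ k-fixes kz = Any.map (λ k≗h → trans (≡.sym (k≗h z)) kz) (stab⁺ S k k∈ k-fixes)

  orbit-refl : ∀ S {z} → Orbit S z z
  orbit-refl S with identity
  ... | e , e∈ , e-id = orbit⁺ S e e∈ (All.tabulate (λ _ → e-id _)) (e-id _)

  orbit-sym : ∀ S {z y} → Orbit S z y → Orbit S y z
  orbit-sym S o with orbit⁻ S o
  ... | k , k∈ , k-fixes , refl with inverse k k∈
  ... | k′ , k′∈ , k′-inv = orbit⁺ S k′ k′∈ (All.map (λ kv → trans (k′-inv _) (fixed-by-inverse k kv)) k-fixes)
                                      (trans (k′-inv _) (inverseˡ k))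

  orbit-trans : ∀ S {z y w} → Orbit S z y → Orbit S y w → Orbit S z w
  orbit-trans S o₁ o₂ with orbit⁻ S o₁ | orbit⁻ S o₂
  ... | k₁ , k₁∈ , k₁-fixes , refl | k₂ , k₂∈ , k₂-fixes , refl with compose k₁ k₂ k₁∈ k₂∈
  ... | k , k∈ , k-comp = orbit⁺ S k k∈ (All.zipWith (λ (k₁v , k₂v) → trans (k-comp _) (trans (cong (k₂ ⟨$⟩ʳ_) k₁v) k₂v))
                                                   (k₁-fixes , k₂-fixes)) (k-comp _)

  orbit-list : List (Fin n) → Fin n → List (Fin n)
  orbit-list S z = filter (orbit? S z) points

  -- If k₀ ∈ X_S maps z to y, then g ↦ k₀⁻¹g is a bijection from {g ∈ X_S | g z = y} onto
  -- X_{z∷S}; so each fibre of g ↦ g z on X_S has |X_{z∷S}| elements.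
  fibre-size : ∀ S z y → Orbit S z y → count (λ g → g ⟨$⟩ʳ z ≟ y) (Stab S) ≡ length (Stab (z ∷ S))
  fibre-size S z y o with orbit⁻ S o
  ... | k₀ , k₀∈ , k₀-fixes , k₀z with inverse k₀ k₀∈
  ... | k₀′ , k₀′∈ , k₀′-inv = ≤-antisym
    (injection-length-≤ (λ (g m : Permutation′ n) → ∀ i → m ⟨$⟩ʳ i ≡ k₀ ⟨$⟩ˡ (g ⟨$⟩ʳ i)) fibre (Stab (z ∷ S))
      (AllPairs.filter⁺ sends? (stab-distinct S)) (All.tabulate (λ {g} m → divide {g} (∈⇒∈ₚ m)))
      (λ r r′ m≗m′ i → ⟨$⟩ˡ-injective k₀ (trans (≡.sym (r i)) (trans (m≗m′ i) (r′ i)))))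
    (injection-length-≤ (λ (m g : Permutation′ n) → ∀ i → g ⟨$⟩ʳ i ≡ k₀ ⟨$⟩ʳ (m ⟨$⟩ʳ i)) (Stab (z ∷ S)) fibre
      (stab-distinct (z ∷ S)) (All.tabulate (λ {m} m∈ → multiply {m} (∈⇒∈ₚ m∈)))
      (λ r r′ g≗g′ i → ⟨$⟩ʳ-injective k₀ (trans (≡.sym (r i)) (trans (g≗g′ i) (r′ i)))))
    where
    Sends : Perm → Set
    Sends g = g ⟨$⟩ʳ z ≡ y
    sends? : ∀ g → Dec (Sends g)
    sends? g = g ⟨$⟩ʳ z ≟ y
    fibre : List Perm
    fibre = filter sends? (Stab S)

    divide : ∀ {g} → Any (g ≗ₚ_) fibre → Σ Perm λ m → Any (m ≗ₚ_) (Stab (z ∷ S)) × (∀ i → m ⟨$⟩ʳ i ≡ k₀ ⟨$⟩ˡ (g ⟨$⟩ʳ i))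
    divide {g} g∈fibre with SetoidMembership.∈-filter⁻ (perm-setoid {n}) sends? (λ {g} {h} g≗h gz → trans (≡.sym (g≗h z)) gz) {v = g} g∈fibre
    ... | g∈S , gz with stab⁻ S g g∈S
    ... | g∈ , g-fixes with compose g k₀′ g∈ k₀′∈
    ... | m , m∈ , m-comp = m , stab⁺ (z ∷ S) m m∈ (m-fixes-z ∷ m-fixes-S) , m≡
      where
      m≡ : ∀ i → m ⟨$⟩ʳ i ≡ k₀ ⟨$⟩ˡ (g ⟨$⟩ʳ i)
      m≡ i = trans (m-comp i) (k₀′-inv _)
      m-fixes-z : m ⟨$⟩ʳ z ≡ z
      m-fixes-z = trans (m≡ z) (trans (cong (k₀ ⟨$⟩ˡ_) (trans gz (≡.sym k₀z))) (inverseˡ k₀))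
      m-fixes-S : Fixes S m
      m-fixes-S = All.zipWith (λ (gv , k₀v) → trans (m≡ _) (trans (cong (k₀ ⟨$⟩ˡ_) gv) (fixed-by-inverse k₀ k₀v)))
                    (g-fixes , k₀-fixes)

    multiply : ∀ {m} → Any (m ≗ₚ_) (Stab (z ∷ S)) → Σ Perm λ g → Any (g ≗ₚ_) fibre × (∀ i → g ⟨$⟩ʳ i ≡ k₀ ⟨$⟩ʳ (m ⟨$⟩ʳ i))
    multiply {m} m∈zS with stab⁻ (z ∷ S) m m∈zS
    ... | m∈ , (mz ∷ m-fixes) with compose m k₀ m∈ k₀∈
    ... | g , g∈ , g-comp = g , SetoidMembership.∈-filter⁺ (perm-setoid {n}) sends? (λ {g} {h} g≗h gz → trans (≡.sym (g≗h z)) gz) {v = g}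
                                  (stab⁺ S g g∈ g-fixes) (trans (g-comp z) (trans (cong (k₀ ⟨$⟩ʳ_) mz) k₀z)) , g-comp
      where
      g-fixes : Fixes S g
      g-fixes = All.zipWith (λ (mv , k₀v) → trans (g-comp _) (trans (cong (k₀ ⟨$⟩ʳ_) mv) k₀v)) (m-fixes , k₀-fixes)

  orbit-stabiliser : ∀ S z → length (Stab S) ≡ length (orbit-list S z) * length (Stab (z ∷ S))
  orbit-stabiliser S z = length-by-fibres _≟_ (λ k → k ⟨$⟩ʳ z) (Stab S) (orbit-list S z)
    (points-filter-distinct (orbit? S z))
    (All.tabulate (λ k∈ → ∈-points-filter (orbit? S z) (Any.map (λ { refl → refl }) k∈)))
    _ (All-filter (orbit? S z) points (All.tabulate (λ _ o → fibre-size S z _ o)))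

  stabiliser-order-constant : VertexTransitive X → ∀ x y → length (Stab (x ∷ [])) ≡ length (Stab (y ∷ []))
  stabiliser-order-constant transitive x y =
    *-cancelˡ-≡ _ _ n {{nonZero-of-Fin x}} (trans (≡.sym (order≡ x)) (order≡ y))
    where
    order≡ : ∀ x → length (Stab []) ≡ n * length (Stab (x ∷ []))
    order≡ x = trans (orbit-stabiliser [] x) (cong (_* length (Stab (x ∷ [])))
      (count-everything (orbit? [] x) (λ w → let (g , g∈ , gx) = transitive x w in orbit⁺ [] g g∈ [] gx)))

  stab-of-all-points : ∀ S → (∀ v → v ∈ S) → length (Stab S) ≡ 1
  stab-of-all-points S everywhere with identity
  ... | e , e∈ , e-id = ≤-antisym
    (injection-length-≤ _≗ₚ_ (Stab S) (e ∷ []) (stab-distinct S)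
      (All.tabulate (λ {g} g∈ → e , here (λ _ → refl) ,
         (λ v → trans (All.lookup (proj₂ (stab⁻ S g (∈⇒∈ₚ g∈))) (everywhere v)) (≡.sym (e-id v)))))
      (λ g≗e g′≗e′ e≗e′ v → trans (g≗e v) (trans (e≗e′ v) (≡.sym (g′≗e′ v)))))
    (stab-nonempty S)

  stabOrder≡ : ∀ x → stabOrder X x ≡ length (Stab (x ∷ []))
  stabOrder≡ x = count-cong (λ g → T? (does (g ⟨$⟩ʳ x ≟ x))) (fixes? (x ∷ [])) (elems X)
    (λ g gx → does-sound (g ⟨$⟩ʳ x ≟ x) gx ∷ []) (λ g gx → does-complete (g ⟨$⟩ʳ x ≟ x) (All.head gx))

  semiregular-or-witness :
    (∀ g x → g ∈G X → g ⟨$⟩ʳ x ≡ x → ∀ i → g ⟨$⟩ʳ i ≡ i) ⊎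
    Σ Perm λ h → h ∈G X × Σ (Fin n) (λ x → h ⟨$⟩ʳ x ≡ x) × Σ (Fin n) (λ i → ¬ h ⟨$⟩ʳ i ≡ i)
  semiregular-or-witness with Any.any? moves-despite-fixing? (elems X)
    where
    moves-despite-fixing? : ∀ h → Dec (Σ (Fin n) (λ x → h ⟨$⟩ʳ x ≡ x) × Σ (Fin n) (λ i → ¬ h ⟨$⟩ʳ i ≡ i))
    moves-despite-fixing? h = any? (λ x → h ⟨$⟩ʳ x ≟ x) ×-dec any? (λ i → ¬? (h ⟨$⟩ʳ i ≟ i))
  ... | yes witness = inj₂ (member-witness witness)
  ... | no none = inj₁ semiregular
    where
    semiregular : ∀ g x → g ∈G X → g ⟨$⟩ʳ x ≡ x → ∀ i → g ⟨$⟩ʳ i ≡ i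
    semiregular g x g∈ gx i with g ⟨$⟩ʳ i ≟ i
    ... | yes gi = gi
    ... | no ¬gi = ⊥-elim (none (Any.map (λ g≗h → (x , trans (≡.sym (g≗h x)) gx) ,
                                                 (i , λ hi → ¬gi (trans (g≗h i) hi))) g∈))

prime-positive : ∀ {p} → Prime p → 1 ≤ p
prime-positive {p} p-prime = <⇒≤ (nonTrivial⇒n>1 p {{prime⇒nonTrivial p-prime}})

exit-edge : ∀ {n} (Γ : Graph n) {S : List (Fin n)} {u z} → Reach Γ u z → u ∈ S → ¬ z ∈ S →
  Σ (Fin n) λ w → Σ (Fin n) λ v → w ∈ S × ¬ v ∈ S × Adj Γ w v
exit-edge Γ here u∈ z∉ = ⊥-elim (z∉ u∈)
exit-edge Γ {S} (step {y = y} u~y rest) u∈ z∉ with Any.any? (y ≟_) S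
... | yes y∈ = exit-edge Γ rest y∈ z∉
... | no y∉ = _ , y , u∈ , y∉ , u~y

neighbour-exists : ∀ {n k} (Γ : Graph n) → 1 ≤ k → Regular Γ k → ∀ x → Σ (Fin n) (Adj Γ x)
neighbour-exists {n} Γ k≥1 regular x with count-witness (λ y → T? (adj Γ x y)) (allFin n)
                                               (subst (1 ≤_) (≡.sym (regular x)) k≥1)
... | y , x~y = y , Equivalence.to T-≡ x~y

module HalfArcTransitive {n : ℕ} (Γ : Graph n) (G : PermGroup n)
  (aut : IsAutGroup Γ G) (vertex-transitive : VertexTransitive G) (edge-transitive : EdgeTransitive Γ G)
  (not-arc-transitive : ¬ ArcTransitive Γ G) {a b : Fin n} (a~b : Adj Γ a b) where
  open GroupTheory G
  open FinCounting n
  open ≡.≡-Reasoning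

  infix 4 _⇀_
  _⇀_ : Fin n → Fin n → Set
  u ⇀ v = Any (λ g → g ⟨$⟩ʳ a ≡ u × g ⟨$⟩ʳ b ≡ v) (elems G)

  _⇀?_ : ∀ u v → Dec (u ⇀ v)
  u ⇀? v = Any.any? (λ g → (g ⟨$⟩ʳ a ≟ u) ×-dec (g ⟨$⟩ʳ b ≟ v)) (elems G)

  ⇀-intro : ∀ g {u v} → g ∈G G → g ⟨$⟩ʳ a ≡ u → g ⟨$⟩ʳ b ≡ v → u ⇀ v
  ⇀-intro g g∈ ga gb = Any.map (λ g≗h → trans (≡.sym (g≗h a)) ga , trans (≡.sym (g≗h b)) gb) g∈

  ⇀-elim : ∀ {u v} → u ⇀ v → Σ Perm λ g → g ∈G G × g ⟨$⟩ʳ a ≡ u × g ⟨$⟩ʳ b ≡ v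
  ⇀-elim = member-witness

  a⇀b : a ⇀ b
  a⇀b = let (e , e∈ , e-id) = identity in ⇀-intro e e∈ (e-id a) (e-id b)

  ⇀-image : ∀ g {u v} → g ∈G G → u ⇀ v → g ⟨$⟩ʳ u ⇀ g ⟨$⟩ʳ v
  ⇀-image g g∈ u⇀v with ⇀-elim u⇀v
  ... | h , h∈ , refl , refl with compose h g h∈ g∈
  ... | k , k∈ , k≡ = ⇀-intro k k∈ (k≡ a) (k≡ b)

  ⇀-preimage : ∀ g {u v} → g ∈G G → g ⟨$⟩ʳ u ⇀ g ⟨$⟩ʳ v → u ⇀ v
  ⇀-preimage g g∈ gu⇀gv with inverse g g∈
  ... | g′ , g′∈ , g′≡ = subst₂ _⇀_ (back _) (back _) (⇀-image g′ g′∈ gu⇀gv)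
    where
    back : ∀ w → g′ ⟨$⟩ʳ (g ⟨$⟩ʳ w) ≡ w
    back w = trans (g′≡ _) (inverseˡ g)

  ⇀-adj : ∀ {u v} → u ⇀ v → Adj Γ u v
  ⇀-adj u⇀v with ⇀-elim u⇀v
  ... | g , g∈ , refl , refl = trans (aut g g∈ a b) a~b

  adj-⇀ : ∀ {u v} → Adj Γ u v → u ⇀ v ⊎ v ⇀ u
  adj-⇀ {u} {v} u~v with edge-transitive a b u v a~b u~v
  ... | g , g∈ , inj₁ (ga , gb) = inj₁ (⇀-intro g g∈ ga gb)
  ... | g , g∈ , inj₂ (ga , gb) = inj₂ (⇀-intro g g∈ ga gb)

  ⇀-transitive : ∀ {x y u v} → x ⇀ y → u ⇀ v → Σ Perm λ g → g ∈G G × g ⟨$⟩ʳ x ≡ u × g ⟨$⟩ʳ y ≡ v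
  ⇀-transitive x⇀y u⇀v with ⇀-elim x⇀y | ⇀-elim u⇀v
  ... | g₁ , g₁∈ , refl , refl | g₂ , g₂∈ , refl , refl with inverse g₁ g₁∈
  ... | g₁′ , g₁′∈ , g₁′≡ with compose g₁′ g₂ g₁′∈ g₂∈
  ... | k , k∈ , k≡ = k , k∈ , back a , back b
    where
    back : ∀ w → k ⟨$⟩ʳ (g₁ ⟨$⟩ʳ w) ≡ g₂ ⟨$⟩ʳ w
    back w = trans (k≡ _) (cong (g₂ ⟨$⟩ʳ_) (trans (g₁′≡ _) (inverseˡ g₁)))

  -- no edge is oriented both ways: otherwise every arc would be oriented, and G would be
  -- arc-transitive
  ⇀-asymmetric : ∀ {u v} → u ⇀ v → ¬ v ⇀ u
  ⇀-asymmetric u⇀v v⇀u with ⇀-elim u⇀v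
  ... | g , g∈ , refl , refl = not-arc-transitive λ x y u v x~y u~v →
                                  ⇀-transitive (every-arc x~y) (every-arc u~v)
    where
    b⇀a : b ⇀ a
    b⇀a = ⇀-preimage g g∈ v⇀u
    every-arc : ∀ {x y} → Adj Γ x y → x ⇀ y
    every-arc x~y with adj-⇀ x~y
    ... | inj₁ x⇀y = x⇀y
    ... | inj₂ y⇀x with ⇀-elim y⇀x
    ...   | h , h∈ , refl , refl = ⇀-image h h∈ b⇀a

  out-degree in-degree : Fin n → ℕ
  out-degree x = count (x ⇀?_) points
  in-degree x = count (_⇀? x) points

  -- every neighbour of x is either an out- or an in-neighbour, but not both
  degree-split : ∀ x → degree Γ x ≡ out-degree x + in-degree x
  degree-split x = trans (count-split (x ⇀?_) neighbours) (cong₂ _+_ outs ins)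
    where
    adj? : Decidable (λ y → T (adj Γ x y))
    adj? y = T? (adj Γ x y)
    neighbours : List (Fin n)
    neighbours = filter adj? points
    outs : count (x ⇀?_) neighbours ≡ out-degree x
    outs = count-filter-weaker adj? (x ⇀?_) points (λ y x⇀y → Equivalence.from T-≡ (⇀-adj x⇀y))
    in-neighbour : ∀ {y} → T (adj Γ x y) → ¬ x ⇀ y → y ⇀ x
    in-neighbour x~y ¬x⇀y with adj-⇀ (Equivalence.to T-≡ x~y)
    ... | inj₁ x⇀y = ⊥-elim (¬x⇀y x⇀y)
    ... | inj₂ y⇀x = y⇀x
    ins : count (λ y → ¬? (x ⇀? y)) neighbours ≡ in-degree x
    ins = trans (count-filter-∧ adj? (λ y → ¬? (x ⇀? y)) points)
      (count-cong _ (_⇀? x) points (λ y (x~y , ¬x⇀y) → in-neighbour x~y ¬x⇀y)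
        (λ y y⇀x → Equivalence.from T-≡ (trans (Graph.sym Γ x y) (⇀-adj y⇀x)) , ⇀-asymmetric y⇀x))

  out-degree-constant : ∀ x → out-degree x ≡ out-degree a
  out-degree-constant x with vertex-transitive a x
  ... | g , g∈ , refl = ≡.sym (count-transport g (a ⇀?_) ((g ⟨$⟩ʳ a) ⇀?_) (λ w → ⇀-image g g∈)
    (λ w ga⇀w → ⇀-preimage g g∈ (subst (_ ⇀_) (≡.sym (inverseʳ g)) ga⇀w)))

  in-degree-constant : ∀ x → in-degree x ≡ in-degree b
  in-degree-constant x with vertex-transitive b x
  ... | g , g∈ , refl = ≡.sym (count-transport g (_⇀? b) (_⇀? (g ⟨$⟩ʳ b)) (λ w → ⇀-image g g∈)
    (λ w w⇀gb → ⇀-preimage g g∈ (subst (_⇀ _) (≡.sym (inverseʳ g)) w⇀gb)))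

  out-neighbour-orbit : ∀ {x y} → x ⇀ y → ∀ w → x ⇀ w → Orbit (x ∷ []) y w
  out-neighbour-orbit x⇀y w x⇀w with ⇀-transitive x⇀y x⇀w
  ... | g , g∈ , gx , gy = orbit⁺ _ g g∈ (gx ∷ []) gy

  orbit-out-neighbour : ∀ {x y} → x ⇀ y → ∀ w → Orbit (x ∷ []) y w → x ⇀ w
  orbit-out-neighbour {x} x⇀y w o with orbit⁻ (x ∷ []) o
  ... | k , k∈ , (kx ∷ []) , ky = subst₂ _⇀_ kx ky (⇀-image k k∈ x⇀y)

  in-neighbour-orbit : ∀ {x y} → x ⇀ y → ∀ w → w ⇀ y → Orbit (y ∷ []) x w
  in-neighbour-orbit x⇀y w w⇀y with ⇀-transitive x⇀y w⇀y
  ... | g , g∈ , gx , gy = orbit⁺ _ g g∈ (gy ∷ []) gx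

  orbit-in-neighbour : ∀ {x y} → x ⇀ y → ∀ w → Orbit (y ∷ []) x w → w ⇀ y
  orbit-in-neighbour {y = y} x⇀y w o with orbit⁻ (y ∷ []) o
  ... | k , k∈ , (ky ∷ []) , kx = subst₂ _⇀_ kx ky (⇀-image k k∈ x⇀y)

  -- |G_a| = out(a)·|G_ab| and |G_b| = in(b)·|G_ab|, while |G_a| = |G_b|
  out-degree≡in-degree : out-degree a ≡ in-degree b
  out-degree≡in-degree = *-cancelʳ-≡ _ _ |G_ab| {{>-nonZero (stab-nonempty _)}} (begin
    out-degree a * |G_ab|               ≡⟨ cong (_* |G_ab|) out-orbit ⟨
    length (orbit-list (a ∷ []) b) * |G_ab|  ≡⟨ orbit-stabiliser (a ∷ []) b ⟨
    length (Stab (a ∷ []))              ≡⟨ stabiliser-order-constant vertex-transitive a b ⟩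
    length (Stab (b ∷ []))              ≡⟨ orbit-stabiliser (b ∷ []) a ⟩
    length (orbit-list (b ∷ []) a) * length (Stab (a ∷ b ∷ []))  ≡⟨ cong₂ _*_ in-orbit (stab-swap a b []) ⟩
    in-degree b * |G_ab|                ∎)
    where
    |G_ab| : ℕ
    |G_ab| = length (Stab (b ∷ a ∷ []))
    out-orbit : length (orbit-list (a ∷ []) b) ≡ out-degree a
    out-orbit = count-cong _ _ points (orbit-out-neighbour a⇀b) (out-neighbour-orbit a⇀b)
    in-orbit : length (orbit-list (b ∷ []) a) ≡ in-degree b
    in-orbit = count-cong _ _ points (orbit-in-neighbour a⇀b) (in-neighbour-orbit a⇀b)

  out-degree≡half-valency : ∀ {r} → Regular Γ (2 * r) → ∀ x → out-degree x ≡ r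
  out-degree≡half-valency {r} regular x = *-cancelˡ-≡ (out-degree x) r 2 (begin
    out-degree x + (out-degree x + 0)  ≡⟨ cong (out-degree x +_) (trans (+-identityʳ _) out≡in) ⟩
    out-degree x + in-degree x         ≡⟨ degree-split x ⟨
    degree Γ x                         ≡⟨ regular x ⟩
    2 * r                              ∎)
    where
    out≡in : out-degree x ≡ in-degree x
    out≡in = trans (out-degree-constant x) (trans out-degree≡in-degree (≡.sym (in-degree-constant x)))

  in-degree≡half-valency : ∀ {r} → Regular Γ (2 * r) → ∀ x → in-degree x ≡ r
  in-degree≡half-valency regular x =
    trans (in-degree-constant x) (trans (≡.sym out-degree≡in-degree)
          (trans (≡.sym (out-degree-constant x)) (out-degree≡half-valency regular x)))

module NormalSubgroup {n : ℕ} (Γ : Graph n) (G N : PermGroup n)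
  (aut : IsAutGroup Γ G) (G-vertex-transitive : VertexTransitive G) (G-edge-transitive : EdgeTransitive Γ G)
  (not-arc-transitive : ¬ ArcTransitive Γ G) {a b : Fin n} (a~b : Adj Γ a b)
  (normal : IsNormalSubgroup N G) (N-vertex-transitive : VertexTransitive N)
  {r : ℕ} (r-prime : Prime r) (regular : Regular Γ (2 * r)) where
  open HalfArcTransitive Γ G aut G-vertex-transitive G-edge-transitive not-arc-transitive a~b
  open GroupTheory N
  open GroupTheory G using () renaming (inverse to G-inverse)
  open FinCounting n

  N⊆G : ∀ k → k ∈G N → k ∈G G
  N⊆G = proj₁ normal

  out-neighbour : ∀ x → Σ (Fin n) (x ⇀_)
  out-neighbour x = count-witness (x ⇀?_) points (subst (1 ≤_) (≡.sym (out-degree≡half-valency regular x)) (prime-positive r-prime))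

  conjugate-orbit : ∀ g {x u w} → g ∈G G → Orbit (x ∷ []) u w → Orbit ((g ⟨$⟩ʳ x) ∷ []) (g ⟨$⟩ʳ u) (g ⟨$⟩ʳ w)
  conjugate-orbit g {x} g∈ o with orbit⁻ (x ∷ []) o
  ... | k , k∈ , (kx ∷ []) , refl with member-witness (proj₂ normal g k g∈ k∈)
  ... | k′ , k′∈ , k′≡ = orbit⁺ _ k′ k′∈ (trans (conj x) (cong (g ⟨$⟩ʳ_) kx) ∷ []) (conj _)
    where
    conj : ∀ v → k′ ⟨$⟩ʳ (g ⟨$⟩ʳ v) ≡ g ⟨$⟩ʳ (k ⟨$⟩ʳ v)
    conj v = trans (k′≡ _) (cong (λ t → g ⟨$⟩ʳ (k ⟨$⟩ʳ t)) (inverseˡ g))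

  ⇀-along-orbit : ∀ {x y w} → x ⇀ y → Orbit (x ∷ []) y w → x ⇀ w
  ⇀-along-orbit {x} x⇀y o with orbit⁻ (x ∷ []) o
  ... | k , k∈ , (kx ∷ []) , ky = subst₂ _⇀_ kx ky (⇀-image k (N⊆G k k∈) x⇀y)

  LocallyTrivial : Fin n → Set
  LocallyTrivial x = ∀ y w → x ⇀ y → Orbit (x ∷ []) y w → w ≡ y

  LocallyTransitive : Fin n → Set
  LocallyTransitive x = ∀ y w → x ⇀ y → x ⇀ w → Orbit (x ∷ []) y w

  -- The N_x-orbits on the r out-neighbours of x are permuted transitively by G_x, so they all
  -- have the size s of the orbit of a chosen out-neighbour y₀; thus s ∣ r, and s ∈ {1, r}.
  module OutNeighbourOrbits (x : Fin n) {y₀ : Fin n} (x⇀y₀ : x ⇀ y₀) where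
    out-neighbours : List (Fin n)
    out-neighbours = filter (x ⇀?_) points

    orbit-size : Fin n → ℕ
    orbit-size y = count (orbit? (x ∷ []) y) out-neighbours

    Class : Fin n → Fin n → Set
    Class y w = x ⇀ w × Orbit (x ∷ []) y w

    class? : ∀ y w → Dec (Class y w)
    class? y w = (x ⇀? w) ×-dec orbit? (x ∷ []) y w

    orbit-size-as-class : ∀ y → orbit-size y ≡ count (class? y) points
    orbit-size-as-class y = count-filter-∧ (x ⇀?_) (orbit? (x ∷ []) y) points

    -- g ∈ G_x with g y = y′ maps the orbit of y into that of y′
    orbit-size-≤ : ∀ {y y′} → x ⇀ y → x ⇀ y′ → orbit-size y ≤ orbit-size y′
    orbit-size-≤ {y} {y′} x⇀y x⇀y′ with ⇀-transitive x⇀y x⇀y′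
    ... | g , g∈ , gx , gy = subst₂ _≤_ (≡.sym (orbit-size-as-class y)) (≡.sym (orbit-size-as-class y′))
      (count-≤-image g (class? y) (class? y′) (λ w (x⇀w , o) →
        subst (_⇀ _) gx (⇀-image g g∈ x⇀w) ,
        subst₂ (λ t u → Orbit (t ∷ []) u _) gx gy (conjugate-orbit g g∈ o)))

    orbit-size-constant : ∀ {y} → x ⇀ y → orbit-size y ≡ orbit-size y₀
    orbit-size-constant x⇀y = ≤-antisym (orbit-size-≤ x⇀y x⇀y₀) (orbit-size-≤ x⇀y₀ x⇀y)

    class-size : ∀ {y} → x ⇀ y → count (class? y) points ≡ orbit-size y₀
    class-size {y} x⇀y = trans (≡.sym (orbit-size-as-class y)) (orbit-size-constant x⇀y)

    orbit-size-divides-r : orbit-size y₀ ∣ r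
    orbit-size-divides-r = subst (_ ∣_) (out-degree≡half-valency regular x)
      (equal-classes-divide (Orbit (x ∷ [])) (orbit? (x ∷ [])) (orbit-refl _) (orbit-sym _) (orbit-trans _)
        _ out-neighbours ≤-refl (points-filter-distinct (x ⇀?_)) _
        (All-filter (x ⇀?_) points (All.tabulate (λ _ → orbit-size-constant))))

    -- orbits of size 1: a second point w in the class of y would give size ≥ 2
    trivial-if-size-1 : orbit-size y₀ ≡ 1 → LocallyTrivial x
    trivial-if-size-1 s≡1 y w x⇀y o with w ≟ y
    ... | yes w≡y = w≡y
    ... | no w≢y = ⊥-elim (1+n≰n (subst (2 ≤_) (trans (class-size x⇀y) s≡1)
            (distinct-≤-count (y ∷ w ∷ []) (class? y) (((λ y≡w → w≢y (≡.sym y≡w)) ∷ []) ∷ [] ∷ [])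
              ((x⇀y , orbit-refl _) ∷ (⇀-along-orbit x⇀y o , o) ∷ []))))

    -- orbits of size r: an out-neighbour w outside the class of y would give r + 1 out-neighbours
    transitive-if-size-r : orbit-size y₀ ≡ r → LocallyTransitive x
    transitive-if-size-r s≡r y w x⇀y x⇀w with orbit? (x ∷ []) y w
    ... | yes o = o
    ... | no ¬o = ⊥-elim (1+n≰n (subst (suc r ≤_) (out-degree≡half-valency regular x)
            (subst (λ t → suc t ≤ out-degree x) (trans (class-size x⇀y) s≡r)
              (distinct-≤-count (w ∷ class) (x ⇀?_) (w∉class ∷ points-filter-distinct (class? y))
                (x⇀w ∷ All.tabulate (λ m → proj₁ (proj₂ (∈-filter⁻ (class? y) {xs = points} m))))))))
      where
      class : List (Fin n)
      class = filter (class? y) points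
      w∉class : All (λ v → ¬ w ≡ v) class
      w∉class = All.tabulate (λ m w≡v → ¬o (subst (Orbit (x ∷ []) y) (≡.sym w≡v)
                                             (proj₂ (proj₂ (∈-filter⁻ (class? y) {xs = points} m)))))

    dichotomy : LocallyTrivial x ⊎ LocallyTransitive x
    dichotomy with prime⇒irreducible r-prime orbit-size-divides-r
    ... | inj₁ s≡1 = inj₁ (trivial-if-size-1 s≡1)
    ... | inj₂ s≡r = inj₂ (transitive-if-size-r s≡r)

  local-dichotomy : ∀ x → LocallyTrivial x ⊎ LocallyTransitive x
  local-dichotomy x = OutNeighbourOrbits.dichotomy x (proj₂ (out-neighbour x))

  locally-trivial-image : ∀ g {x} → g ∈G G → LocallyTrivial x → LocallyTrivial (g ⟨$⟩ʳ x)
  locally-trivial-image g {x} g∈ trivial y w gx⇀y o with G-inverse g g∈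
  ... | g′ , g′∈ , g′≡ = ⟨$⟩ʳ-injective g′
    (trivial _ _ (subst (_⇀ _) (back x) (⇀-image g′ g′∈ gx⇀y))
             (subst (λ t → Orbit (t ∷ []) _ _) (back x) (conjugate-orbit g′ g′∈ o)))
    where
    back : ∀ v → g′ ⟨$⟩ʳ (g ⟨$⟩ʳ v) ≡ v
    back v = trans (g′≡ _) (inverseˡ g)

  locally-trivial-everywhere : ∀ {x} → LocallyTrivial x → ∀ z → LocallyTrivial z
  locally-trivial-everywhere {x} trivial z with G-vertex-transitive x z
  ... | g , g∈ , refl = locally-trivial-image g g∈ trivial

  fixes-out-neighbour : ∀ {x y} k → LocallyTrivial x → k ∈G N → k ⟨$⟩ʳ x ≡ x → x ⇀ y → k ⟨$⟩ʳ y ≡ y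
  fixes-out-neighbour {x} k trivial k∈ kx x⇀y = trivial _ _ x⇀y (orbit⁺ (x ∷ []) k k∈ (kx ∷ []) refl)

  -- If N_γ fixes every out-neighbour w of γ then N_γ ⊆ N_w; as |N_γ| = |N_w| these stabilisers
  -- coincide, so N_w also fixes its in-neighbour γ.
  fixes-in-neighbour : (∀ z → LocallyTrivial z) → ∀ {γ w} k → γ ⇀ w → k ∈G N → k ⟨$⟩ʳ w ≡ w → k ⟨$⟩ʳ γ ≡ γ
  fixes-in-neighbour trivial {γ} {w} k γ⇀w k∈ kw with k ⟨$⟩ʳ γ ≟ γ
  ... | yes kγ = kγ
  ... | no ¬kγ = ⊥-elim (<-irrefl (stabiliser-order-constant N-vertex-transitive γ w)
      (count-mono-< (fixes? (γ ∷ [])) (fixes? (w ∷ [])) (elems N)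
        (All.tabulate (λ {h} h∈ hγ → fixes-out-neighbour h (trivial γ) (∈⇒∈ₚ h∈) (All.head hγ) γ⇀w ∷ []))
        (Any.map (λ {h} k≗h → (trans (≡.sym (k≗h w)) kw ∷ []) , (λ hγ → ¬kγ (trans (k≗h γ) (All.head hγ)))) k∈)))

  -- local triviality everywhere makes N semiregular: walk from a fixed point along edges
  semiregular-if-locally-trivial : Connected Γ → (∀ z → LocallyTrivial z) →
    ∀ k {x} → k ∈G N → k ⟨$⟩ʳ x ≡ x → ∀ z → k ⟨$⟩ʳ z ≡ z
  semiregular-if-locally-trivial connected trivial k {x} k∈ kx z = walk (connected x z) kx
    where
    walk : ∀ {u v} → Reach Γ u v → k ⟨$⟩ʳ u ≡ u → k ⟨$⟩ʳ v ≡ v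
    walk here ku = ku
    walk (step u~v rest) ku with adj-⇀ u~v
    ... | inj₁ u⇀v = walk rest (fixes-out-neighbour k (trivial _) k∈ ku u⇀v)
    ... | inj₂ v⇀u = walk rest (fixes-in-neighbour trivial k v⇀u k∈ ku)

  locally-transitive-everywhere : Connected Γ → ∀ h {x₀ i₀} → h ∈G N → h ⟨$⟩ʳ x₀ ≡ x₀ → ¬ h ⟨$⟩ʳ i₀ ≡ i₀ →
    ∀ x → LocallyTransitive x
  locally-transitive-everywhere connected h {x₀} {i₀} h∈ hx₀ hi₀ x =
    [ (λ trivial → ⊥-elim (hi₀ (semiregular-if-locally-trivial connected
                                  (locally-trivial-everywhere trivial) h h∈ hx₀ i₀)))
    , (λ transitive → transitive) ]′ (local-dichotomy x)

  -- with N_x transitive on the r out-neighbours of x, orbit–stabiliser gives r ∣ |N_x|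
  r-divides-stabiliser : ∀ {x} → LocallyTransitive x → r ∣ length (Stab (x ∷ []))
  r-divides-stabiliser {x} transitive with out-neighbour x
  ... | y₀ , x⇀y₀ = subst (r ∣_) (≡.sym (orbit-stabiliser (x ∷ []) y₀))
      (subst (λ t → r ∣ t * length (Stab (y₀ ∷ x ∷ []))) (≡.sym orbit-size≡r) (m∣m*n _))
    where
    orbit-size≡r : length (orbit-list (x ∷ []) y₀) ≡ r
    orbit-size≡r = trans (count-cong _ (x ⇀?_) points (λ w → ⇀-along-orbit x⇀y₀) (λ w → transitive _ w x⇀y₀))
                         (out-degree≡half-valency regular x)

  N-⇀-transitive : (∀ z → LocallyTransitive z) →
    ∀ {x y u v} → x ⇀ y → u ⇀ v → Σ Perm λ k → k ∈G N × k ⟨$⟩ʳ x ≡ u × k ⟨$⟩ʳ y ≡ v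
  N-⇀-transitive transitive {x} {y} {u} x⇀y u⇀v with N-vertex-transitive x u
  ... | k₁ , k₁∈ , k₁x with orbit⁻ (u ∷ []) (transitive u _ _ (subst (_⇀ _) k₁x (⇀-image k₁ (N⊆G k₁ k₁∈) x⇀y)) u⇀v)
  ... | k₂ , k₂∈ , (k₂u ∷ []) , k₂y with compose k₁ k₂ k₁∈ k₂∈
  ... | k , k∈ , k≡ = k , k∈ , trans (k≡ x) (trans (cong (k₂ ⟨$⟩ʳ_) k₁x) k₂u) , trans (k≡ y) k₂y

  N-edge-transitive : (∀ z → LocallyTransitive z) → EdgeTransitive Γ N
  N-edge-transitive transitive x y u v x~y u~v with adj-⇀ x~y | adj-⇀ u~v
  ... | inj₁ x⇀y | inj₁ u⇀v = let (k , k∈ , kx , ky) = N-⇀-transitive transitive x⇀y u⇀v in k , k∈ , inj₁ (kx , ky)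
  ... | inj₁ x⇀y | inj₂ v⇀u = let (k , k∈ , kx , ky) = N-⇀-transitive transitive x⇀y v⇀u in k , k∈ , inj₂ (kx , ky)
  ... | inj₂ y⇀x | inj₁ u⇀v = let (k , k∈ , ky , kx) = N-⇀-transitive transitive y⇀x u⇀v in k , k∈ , inj₂ (kx , ky)
  ... | inj₂ y⇀x | inj₂ v⇀u = let (k , k∈ , ky , kx) = N-⇀-transitive transitive y⇀x v⇀u in k , k∈ , inj₁ (kx , ky)

  -- the N_S-orbit of a neighbour z of some w ∈ S lies among the r out- or r in-neighbours of w
  orbit-size-≤-r : ∀ {S w z} → w ∈ S → Adj Γ w z → length (orbit-list S z) ≤ r
  orbit-size-≤-r {S} {w} {z} w∈ w~z with adj-⇀ w~z
  ... | inj₁ w⇀z = subst (_ ≤_) (out-degree≡half-valency regular w)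
      (count-mono-≤ (orbit? S z) (w ⇀?_) points (All.tabulate (λ _ o →
        let (k , k∈ , k-fixes , kz) = orbit⁻ S o in subst₂ _⇀_ (All.lookup k-fixes w∈) kz (⇀-image k (N⊆G k k∈) w⇀z))))
  ... | inj₂ z⇀w = subst (_ ≤_) (in-degree≡half-valency regular w)
      (count-mono-≤ (orbit? S z) (_⇀? w) points (All.tabulate (λ _ o →
        let (k , k∈ , k-fixes , kz) = orbit⁻ S o in subst₂ _⇀_ kz (All.lookup k-fixes w∈) (⇀-image k (N⊆G k k∈) z⇀w))))

  orbit-nonempty : ∀ S z → 1 ≤ length (orbit-list S z)
  orbit-nonempty S z = count-pos (orbit? S z) points (Any.map (λ { refl → orbit-refl S }) (∈-allFin z))

  -- If S misses a vertex, some edge w ~ z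
  -- leaves S, and p divides |N_S| = |z^{N_S}|·|N_{z∷S}| where |z^{N_S}| ≤ r; so either p ≤ r or
  -- p divides |N_{z∷S}| and we recurse (fuel bounds the number of missing vertices).  If S
  -- contains every vertex then N_S is trivial.
  prime-divisor-≤-r : Connected Γ → ∀ fuel S {u} → u ∈ S → missing S ≤ fuel →
    ∀ {p} → Prime p → p ∣ length (Stab S) → p ≤ r
  prime-divisor-≤-r connected fuel S u∈ enough p-prime p∣ with any? (outside? S)
  ... | no none = ⊥-elim (¬prime[1] (subst Prime (∣1⇒≡1 (subst (_ ∣_) (stab-of-all-points S inside) p∣)) p-prime))
    where
    inside : ∀ v → v ∈ S
    inside v with Any.any? (v ≟_) S
    ... | yes v∈ = v∈
    ... | no v∉ = ⊥-elim (none (v , v∉))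
  ... | yes (z₀ , z₀∉) with exit-edge Γ (connected _ z₀) u∈ z₀∉
  ... | w , z , w∈ , z∉ , w~z
    with euclidsLemma (length (orbit-list S z)) (length (Stab (z ∷ S))) p-prime (subst (_ ∣_) (orbit-stabiliser S z) p∣)
  ... | inj₁ p∣orbit = ≤-trans (∣⇒≤ {{>-nonZero (orbit-nonempty S z)}} p∣orbit) (orbit-size-≤-r w∈ w~z)
  ... | inj₂ p∣stab with fuel | ≤-trans (missing-decreases z∉) enough
  ...   | suc fuel′ | s≤s enough′ = prime-divisor-≤-r connected fuel′ (z ∷ S) (there u∈) enough′ p-prime p∣stab

  prime-divisor-of-stabiliser-≤-r : Connected Γ → ∀ x {p} → Prime p → p ∣ length (Stab (x ∷ [])) → p ≤ r
  prime-divisor-of-stabiliser-≤-r connected x = prime-divisor-≤-r connected n (x ∷ []) (here refl)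
    (≤-trans (length-filter (outside? (x ∷ [])) points) (≤-reflexive (length-tabulate (λ v → v))))

-- Either N is semiregular, hence (being transitive) regular; or some element of N fixes a point
-- and moves another, and then N is locally transitive everywhere, which yields the second
-- alternative.
corollary3p4 : (n r : ℕ) (Γ : Graph n) (G N : PermGroup n) (α : Fin n) →
  Prime r → Connected Γ → Regular Γ (2 * r) →
  IsAutGroup Γ G → VertexTransitive G → EdgeTransitive Γ G →
  ¬ TwoArcTransitive Γ G → ¬ ArcTransitive Γ G →
  IsNormalSubgroup N G → VertexTransitive N →
  RegularOn N ⊎
    (IsMaxPrimeDivisor r (stabOrder N α) × VertexTransitive N × EdgeTransitive Γ N)
corollary3p4 n r Γ G N α r-prime connected regular aut G-vertex-transitive G-edge-transitive _
  not-arc-transitive normal N-vertex-transitive with GroupTheory.semiregular-or-witness N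
... | inj₁ semiregular = inj₁ (N-vertex-transitive , semiregular)
... | inj₂ (h , h∈ , (x₀ , hx₀) , (i₀ , hi₀)) =
  inj₂ ((r-prime , r∣|N_α| , prime-bound) , N-vertex-transitive , N-edge-transitive locally-transitive)
  where
  β~ : Σ (Fin n) (Adj Γ α)
  β~ = neighbour-exists Γ (≤-trans (prime-positive r-prime) (m≤m+n r (r + 0))) regular α
  open NormalSubgroup Γ G N aut G-vertex-transitive G-edge-transitive not-arc-transitive (proj₂ β~)
                      normal N-vertex-transitive r-prime regular
  open GroupTheory N using (stabOrder≡)
  locally-transitive : ∀ x → LocallyTransitive x
  locally-transitive = locally-transitive-everywhere connected h h∈ hx₀ hi₀
  r∣|N_α| : r ∣ stabOrder N α
  r∣|N_α| = subst (r ∣_) (≡.sym (stabOrder≡ α)) (r-divides-stabiliser (locally-transitive α))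
  prime-bound : ∀ p → Prime p → p ∣ stabOrder N α → p ≤ r
  prime-bound p p-prime p∣ = prime-divisor-of-stabiliser-≤-r connected α p-prime (subst (p ∣_) (stabOrder≡ α) p∣)
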